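{- For any three non-negative integers $a,b,c$ such that $a\neq b$ and $b\neq c$, the values $\textsc{CVChoice}(a,b)$ and $\textsc{CVChoice}(b,c)$ are different integers.
   Context: A binary string $S$ of length $\ell\ge1$ is written $S=s_{\ell-1}\cdots s_0$ and $S[i]$ denotes $s_i$ (index $0$ is the rightmost bit). $\textsc{BinaryRep}(n)$ is the base-2 representation of the non-negative integer $n$ without leading zeros (with $\textsc{BinaryRep}(0)=0$), and $\textsc{IntVal}(S)$ is the integer whose base-2 representation is $S$; $\cdot$ denotes concatenation. For a binary string $S$ of length $\ell\ge1$, $\textsc{EncodeSF}(S)$ is the string $S'$ of length $2\ell+2$ with $S'[2\ell+1]=S'[2\ell]=0$ and $S'[2i+1]=S[i]$, $S'[2i]=1-S[i]$ for $i\in\{0,\dots,\ell-1\}$. For non-negative integers $x\ne y$, $\textsc{CVChoice}(x,y)$ is computed as follows: let $X=\textsc{EncodeSF}(\textsc{BinaryRep}(x))$ and $Y=\textsc{EncodeSF}(\textsc{BinaryRep}(y))$; let $i$ be the smallest index $\ge0$ such that $X[i]\neq Y[i]$; return $\textsc{IntVal}(\textsc{BinaryRep}(i)\cdot X[i])$. -}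

module Defs where

open import Data.Nat using (ℕ; zero; suc; _+_; _*_)
open import Data.Nat.DivMod using (_/_; _%_)
open import Data.Bool using (Bool; true; false; not; _≟_)
open import Data.List using (List; []; _∷_; _++_)
open import Data.Maybe using (Maybe; just; nothing)
open import Data.Product using (_×_; _,_)
open import Relation.Nullary using (yes; no)
open import Induction.WellFounded using ()
open import Data.Nat.Induction using (<-rec)

-- Binary strings are represented as lists of bits in LSB-first order:
-- the head of the list is S[0] (the rightmost bit), the i-th element is S[i].
-- true = 1, false = 0.

BitString : Set
BitString = List Bool

-- Bits of a positive number, LSB first, via fuel (fuel n suffices for n).
bitsFuel : ℕ → ℕ → BitString
bitsFuel zero    _ = []
bitsFuel (suc f) zero = []
bitsFuel (suc f) n@(suc _) = (n % 2 Data.Nat.≡ᵇ 1) ∷ bitsFuel f (n / 2)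

binaryRep : ℕ → BitString
binaryRep zero = false ∷ []
binaryRep n@(suc _) = bitsFuel n n

-- EncodeSF: S'[2i+1] = S[i], S'[2i] = 1 - S[i], and S'[2ℓ] = S'[2ℓ+1] = 0.
encodeSF : BitString → BitString
encodeSF [] = false ∷ false ∷ []
encodeSF (s ∷ S) = not s ∷ s ∷ encodeSF S

firstDiff : ℕ → BitString → BitString → Maybe (ℕ × Bool)
firstDiff k [] _ = nothing
firstDiff k (_ ∷ _) [] = nothing
firstDiff k (x ∷ X) (y ∷ Y) with x ≟ y
... | yes _ = firstDiff (suc k) X Y
... | no  _ = just (k , x)

bitVal : Bool → ℕ
bitVal true  = 1
bitVal false = 0

-- IntVal(BinaryRep(i) · b) = 2 i + b  (appending bit b as the new rightmost bit).
-- The fallback value 0 is only used when no differing index exists,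
-- which cannot happen for x ≠ y.
cvChoice : ℕ → ℕ → ℕ
cvChoice x y with firstDiff 0 (encodeSF (binaryRep x)) (encodeSF (binaryRep y))
... | just (i , b) = 2 * i + bitVal b
... | nothing      = 0

{-# OPTIONS --safe #-}
module Submission where

open import Defs
open import Data.Bool using (true; false; not) renaming (_≟_ to _≟ᵇ_)
open import Data.Bool.Properties using (not-¬)
open import Data.List using ([]; _∷_; head; drop)
open import Data.Maybe using (just; nothing)
open import Data.Maybe.Properties using (just-injective)
open import Data.Nat using (ℕ; zero; suc; _+_; _*_; _≤_; z≤n; s≤s; _≡ᵇ_)
open import Data.Nat.DivMod using (_/_; _%_; m%n<n; m/n<m; m≡m%n+[m/n]*n)
open import Data.Nat.Properties
  using (≤-refl; ≤-trans; ≤-pred; *-comm; *-cancelˡ-≡; +-cancelʳ-≡; +-identityʳ; +-comm; +-suc; even≢odd)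
open import Data.Product using (∃; ∃₂; _×_; _,_)
open import Function using (_∘_)
open import Relation.Nullary using (yes; no; contradiction)
open import Relation.Binary.PropositionalEquality

-- Let X, Y be the encodings of a, b. If X and Y first differ at i, then
-- CVChoice(a, b) = 2i + X[i] with Y[i] = not X[i], while CVChoice(b, c) = 2j + Y[j].
-- Equal values force i = j and X[i] = Y[i], a contradiction. The self-delimiting
-- encoding is only needed to guarantee that distinct numbers have a first difference.

fromBits : BitString → ℕ
fromBits []      = 0
fromBits (b ∷ S) = bitVal b + 2 * fromBits S

bitVal-%2 : ∀ m → bitVal (m % 2 ≡ᵇ 1) ≡ m % 2
bitVal-%2 m with m % 2 | m%n<n m 2
... | 0 | _ = refl
... | 1 | _ = refl
... | suc (suc _) | s≤s (s≤s ())

fromBits-bitsFuel : ∀ f n → n ≤ f → fromBits (bitsFuel f n) ≡ n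
fromBits-bitsFuel zero    zero    _        = refl
fromBits-bitsFuel (suc f) zero    _        = refl
fromBits-bitsFuel (suc f) (suc n) (s≤s n≤f) = begin
  bitVal (suc n % 2 ≡ᵇ 1) + 2 * fromBits (bitsFuel f (suc n / 2))
    ≡⟨ cong₂ _+_ (bitVal-%2 (suc n)) (cong (2 *_) (fromBits-bitsFuel f (suc n / 2) half≤f)) ⟩
  suc n % 2 + 2 * (suc n / 2)
    ≡⟨ cong (suc n % 2 +_) (*-comm 2 (suc n / 2)) ⟩
  suc n % 2 + suc n / 2 * 2
    ≡⟨ m≡m%n+[m/n]*n (suc n) 2 ⟨
  suc n ∎
  where
  open ≡-Reasoning
  half≤f : suc n / 2 ≤ f
  half≤f = ≤-trans (≤-pred (m/n<m (suc n) 2 (s≤s (s≤s z≤n)))) n≤f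

fromBits-binaryRep : ∀ n → fromBits (binaryRep n) ≡ n
fromBits-binaryRep zero    = refl
fromBits-binaryRep (suc n) = fromBits-bitsFuel (suc n) (suc n) ≤-refl

binaryRep-injective : ∀ {m n} → binaryRep m ≡ binaryRep n → m ≡ n
binaryRep-injective {m} {n} eq =
  trans (sym (fromBits-binaryRep m)) (trans (cong fromBits eq) (fromBits-binaryRep n))

firstDiff-encodeSF : ∀ k S T → S ≢ T → ∃ λ r → firstDiff k (encodeSF S) (encodeSF T) ≡ just r
firstDiff-encodeSF k []          []          S≢T = contradiction refl S≢T
firstDiff-encodeSF k []          (false ∷ T) _   = _ , refl
firstDiff-encodeSF k []          (true ∷ T)  _   = _ , refl
firstDiff-encodeSF k (false ∷ S) []          _   = _ , refl
firstDiff-encodeSF k (true ∷ S)  []          _   = _ , refl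
firstDiff-encodeSF k (false ∷ S) (true ∷ T)  _   = _ , refl
firstDiff-encodeSF k (true ∷ S)  (false ∷ T) _   = _ , refl
firstDiff-encodeSF k (false ∷ S) (false ∷ T) S≢T = firstDiff-encodeSF (2 + k) S T (S≢T ∘ cong (false ∷_))
firstDiff-encodeSF k (true ∷ S)  (true ∷ T)  S≢T = firstDiff-encodeSF (2 + k) S T (S≢T ∘ cong (true ∷_))

firstDiff-sound : ∀ k X Y {i b} → firstDiff k X Y ≡ just (i , b) →
  ∃ λ m → i ≡ k + m × head (drop m X) ≡ just b × head (drop m Y) ≡ just (not b)
firstDiff-sound k (x ∷ X) (y ∷ Y) eq with x ≟ᵇ y
... | yes _ with firstDiff-sound (suc k) X Y eq
...   | m , i≡k+1+m , Xm , Ym = suc m , trans i≡k+1+m (sym (+-suc k m)) , Xm , Ym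
firstDiff-sound k (false ∷ X) (true ∷ Y)  refl | no _ = 0 , sym (+-identityʳ k) , refl , refl
firstDiff-sound k (true ∷ X)  (false ∷ Y) refl | no _ = 0 , sym (+-identityʳ k) , refl , refl
firstDiff-sound k (false ∷ X) (false ∷ Y) _    | no x≢y = contradiction refl x≢y
firstDiff-sound k (true ∷ X)  (true ∷ Y)  _    | no x≢y = contradiction refl x≢y

2*-+-bitVal-injective : ∀ i j b c → 2 * i + bitVal b ≡ 2 * j + bitVal c → i ≡ j × b ≡ c
2*-+-bitVal-injective i j false false eq = *-cancelˡ-≡ i j 2 (+-cancelʳ-≡ _ _ _ eq) , refl
2*-+-bitVal-injective i j true  true  eq = *-cancelˡ-≡ i j 2 (+-cancelʳ-≡ _ _ _ eq) , refl
2*-+-bitVal-injective i j false true  eq =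
  contradiction (trans (sym (+-identityʳ (2 * i))) (trans eq (+-comm (2 * j) 1))) (even≢odd i j)
2*-+-bitVal-injective i j true  false eq =
  contradiction (trans (sym (+-identityʳ (2 * j))) (trans (sym eq) (+-comm (2 * i) 1))) (even≢odd j i)

cvChoice-spec : ∀ x y → x ≢ y → ∃₂ λ i b →
  cvChoice x y ≡ 2 * i + bitVal b ×
  head (drop i (encodeSF (binaryRep x))) ≡ just b ×
  head (drop i (encodeSF (binaryRep y))) ≡ just (not b)
cvChoice-spec x y x≢y with firstDiff 0 (encodeSF (binaryRep x)) (encodeSF (binaryRep y)) in eq
... | just (i , b) with firstDiff-sound 0 _ _ eq
...   | m , refl , Xm , Ym = m , b , refl , Xm , Ym
cvChoice-spec x y x≢y | nothing
  with firstDiff-encodeSF 0 (binaryRep x) (binaryRep y) (x≢y ∘ binaryRep-injective)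
...   | _ , eq′ with () ← trans (sym eq) eq′

mainTheorem9 : (a b c : ℕ) → a ≢ b → b ≢ c → cvChoice a b ≢ cvChoice b c
mainTheorem9 a b c a≢b b≢c eq
  with cvChoice-spec a b a≢b | cvChoice-spec b c b≢c
... | i , x , eqᵃᵇ , _ , Yᵢ≡¬x | j , y , eqᵇᶜ , Yⱼ≡y , _
  with refl , refl ← 2*-+-bitVal-injective i j x y (trans (sym eqᵃᵇ) (trans eq eqᵇᶜ))
  = not-¬ refl (just-injective (trans (sym Yⱼ≡y) Yᵢ≡¬x))
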